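{- Let $(W,S)$ be a finite Coxeter system. Then $\tilde S=W$, and $\mathcal A_{\tilde S}(W,S)$ is the minimal automaton recognizing $\operatorname{Red}(W,S)$.
   Context: $\ell$ is the length function; right weak order $u\le_R w$ iff $\ell(w)=\ell(u)+\ell(u^{ -1}w)$; bounded subsets have joins $\bigvee$; $v$ is a suffix of $w$ if $\ell(w)=\ell(wv^{ -1})+\ell(v)$. A Garside shadow is $B\subseteq W$ with $S\subseteq B$, closed under joins of bounded subsets and under taking suffixes; $\pi_B(w)=\bigvee\{g\in B\mid g\le_R w\}$; $\tilde S$ is the smallest Garside shadow. $\mathcal A_B(W,S)$ is the automaton over $S$ with states $B$, initial state $e$, all states final, transitions $x\overset{s}{\rightarrow}\pi_B(sx)$ whenever $\ell(sx)>\ell(x)$. $\operatorname{Red}(W,S)$ is the set of words $s_1\cdots s_k$ over $S$ with $\ell(s_1\cdots s_k)=k$. The minimal automaton of a regular language is the (unique up to isomorphism) deterministic automaton recognizing it that is a quotient of every (complete) deterministic automaton recognizing it; an automaton with all states reachable is minimal iff no two distinct states are equivalent, where two states are equivalent if the same set of words is accepted when starting from either. -}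

module Defs where

open import Level using (Level; _⊔_) renaming (zero to lzero; suc to lsuc)
open import Data.Nat using (ℕ; zero; suc; _+_; _≤_; _<_)
open import Data.Fin using (Fin)
open import Data.Maybe using (Maybe; just)
open import Data.List using (List; []; _∷_; _++_; [_]; length; reverse; concat; replicate)
open import Data.List.Membership.Propositional using (_∈_)
open import Data.Product using (Σ; ∃; _×_; _,_)
open import Data.Unit.Polymorphic using (⊤)
open import Relation.Binary.PropositionalEquality using (_≡_; _≢_)
open import Relation.Binary.Construct.Closure.Equivalence using (EqClosure)

-- A Coxeter matrix on the index set Fin n; `nothing` encodes m = ∞.
record CoxeterMatrix (n : ℕ) : Set where
  field
    m      : Fin n → Fin n → Maybe ℕ
    diag   : ∀ i → m i i ≡ just 1
    sym    : ∀ i j → m i j ≡ m j i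
    offdiag : ∀ i j → i ≢ j → ∀ k → m i j ≡ just k → 2 ≤ k

module Coxeter {n : ℕ} (M : CoxeterMatrix n) where
  open CoxeterMatrix M

  Word : Set
  Word = List (Fin n)

  relator : Fin n → Fin n → ℕ → Word
  relator i j k = concat (replicate k (i ∷ j ∷ []))

  data RelStep : Word → Word → Set where
    elim : ∀ u v i j k → m i j ≡ just k → RelStep (u ++ relator i j k ++ v) (u ++ v)

  -- equality in W = ⟨ S | (s_i s_j)^{m_ij} ⟩ : congruence generated by the relators
  infix 4 _≈_
  _≈_ : Word → Word → Set
  _≈_ = EqClosure RelStep

  Finite : Set
  Finite = Σ (List Word) λ L → ∀ w → ∃ λ u → u ∈ L × w ≈ u

  -- inverse (generators are involutions)
  inv : Word → Word
  inv = reverse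

  Len : Word → ℕ → Set
  Len w k = (∃ λ u → u ≈ w × length u ≡ k) × (∀ u → u ≈ w → k ≤ length u)

  _≤R_ : Word → Word → Set
  u ≤R w = ∃ λ a → ∃ λ b → ∃ λ c → Len u a × Len (inv u ++ w) b × Len w c × c ≡ a + b

  Suffix : Word → Word → Set
  Suffix v w = ∃ λ a → ∃ λ b → ∃ λ c → Len (w ++ inv v) a × Len v b × Len w c × c ≡ a + b

  UpperBound : ∀ {ℓ} → (Word → Set ℓ) → Word → Set ℓ
  UpperBound X b = ∀ x → X x → x ≤R b

  Bounded : ∀ {ℓ} → (Word → Set ℓ) → Set ℓ
  Bounded X = ∃ λ b → UpperBound X b

  IsJoin : ∀ {ℓ} → (Word → Set ℓ) → Word → Set ℓ
  IsJoin X j = UpperBound X j × (∀ b → UpperBound X b → j ≤R b)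

  record IsGarsideShadow {ℓ} (B : Word → Set ℓ) : Set (lsuc ℓ) where
    field
      respects   : ∀ u w → u ≈ w → B u → B w
      gens       : ∀ i → B [ i ]
      joinClosed : (X : Word → Set ℓ) → (∀ x → X x → B x) → Bounded X →
                   ∀ j → IsJoin X j → B j
      suffixClosed : ∀ w v → B w → Suffix v w → B v

  S̃ : Word → Set₁
  S̃ w = (B : Word → Set) → IsGarsideShadow B → B w

  -- Automaton A_B(W,S): states B, initial e, all final,
  -- transitions x --s--> π_B(s x) when ℓ(s x) > ℓ(x)
  module Automaton {ℓ} (B : Word → Set ℓ) where
    IsπB : Word → Word → Set ℓ
    IsπB w y = IsJoin (λ g → B g × g ≤R w) y

    Trans : Word → Fin n → Word → Set ℓ
    Trans x i y = (∃ λ a → ∃ λ b → Len x a × Len (i ∷ x) b × a < b) × B y × IsπB (i ∷ x) y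

    Run : Word → List (Fin n) → Word → Set ℓ
    Run x []       y = x ≈ y × ⊤
    Run x (i ∷ ws) y = ∃ λ z → Trans x i z × Run z ws y

    Accepts : Word → List (Fin n) → Set ℓ
    Accepts x []       = ⊤
    Accepts x (i ∷ ws) = ∃ λ z → Trans x i z × Accepts z ws

  Red : List (Fin n) → Set
  Red ws = Len ws (length ws)

  record IsMinimalForRed {ℓ} (B : Word → Set ℓ) : Set ℓ where
    open Automaton B
    field
      recognizes  : ∀ ws → (Accepts [] ws → Red ws) × (Red ws → Accepts [] ws)
      reachable   : ∀ y → B y → ∃ λ ws → Run [] ws y
      inequivalent : ∀ x y → B x → B y →
                     (∀ ws → (Accepts x ws → Accepts y ws) × (Accepts y ws → Accepts x ws)) →
                     x ≈ y

{-# OPTIONS --safe #-}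

-- Finiteness makes equality in W decidable, so the length ℓ can be computed by exhaustive search.
-- Tits' reflection cocycle χ w t, the parity of the occurrences of t among the reflections
-- s₁, s₁s₂s₁, … of a word w, is invariant under the relations, and χ w t = true forces
-- ℓ (t w) < ℓ w.  Consequently a longest element w₀ has every reflection as an inversion, which
-- gives ℓ (w₀ v⁻¹) + ℓ v = ℓ w₀ for every v: every element is a suffix of w₀, and w₀ is the join
-- of S.  So every Garside shadow is all of W, π is the identity, and the automaton moves from x
-- to s x exactly when ℓ (s x) > ℓ x.  It therefore accepts from x the words along which the
-- length grows by one per letter: from e these are the reduced words, and the reverse of a reduced
-- word of w₀ x⁻¹ is accepted from a state y only if ℓ y ≤ ℓ x, with equality only for y = x.

module Submission where

open import Defs
open import Level using (0ℓ)
open import Data.Nat using (ℕ; zero; suc; _+_; _≤_; _<_; z≤n; s≤s; s≤s⁻¹)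
open import Data.Nat.Properties
  using ( ≤-refl; ≤-reflexive; ≤-trans; ≤-antisym; <⇒≤; <⇒≱; ≤∧≢⇒<; <-irrefl; n≤1+n; n<1+n; n≤0⇒n≡0
        ; n≢0⇒n>0; suc-injective; +-suc; +-identityʳ; +-comm; +-assoc; +-cancelˡ-≡; +-cancelʳ-≡
        ; +-cancelˡ-≤; m+n≡0⇒m≡0; m<n+m; +-mono-≤; +-monoˡ-≤; +-mono-<; +-monoʳ-<; +-mono-<-≤; +-mono-≤-<
        ; module ≤-Reasoning )
open import Data.Nat.Induction using (<-wellFounded)
open import Data.Fin using (Fin; zero; suc; toℕ)
open import Data.Fin.Properties using (_≟_; <-cmp; any?)
open import Data.Sum using (_⊎_; inj₁; inj₂)
open import Data.Empty using (⊥-elim)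
open import Induction.WellFounded using (Acc; acc)
open import Relation.Nullary using (Dec; yes; no; ¬_; does)
open import Relation.Nullary.Decidable using (map′)
open import Relation.Binary.Definitions using (tri<; tri≈; tri>)
open import Data.List.Relation.Unary.Any using (index)
import Data.List.Relation.Unary.All as All
open import Data.List.Extrema.Nat using (argmax; f[xs]≤f[argmax])
open import Data.List.Relation.Unary.Any.Properties using (lookup-index)
open import Data.Maybe using (just; nothing)
open import Data.Bool using (Bool; true; false; _xor_)
open import Data.Bool.Properties using (xor-assoc; xor-comm; xor-same; xor-identityʳ)
open import Data.List using (List; []; _∷_; _++_; [_]; length; reverse; lookup; map)
open import Data.List.Properties
  using ( ++-assoc; ++-identityʳ; reverse-++; reverse-involutive; unfold-reverse; length-++; length-reverse
        ; map-++; map-cong; map-∘; map-id )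
open import Data.Product using (Σ; ∃; ∃₂; _×_; _,_; proj₁; proj₂)
open import Relation.Binary.Bundles using (Setoid)
open import Data.Unit.Polymorphic using (tt)
open import Relation.Binary.PropositionalEquality
  using (_≡_; _≢_; refl; sym; trans; cong; cong₂; subst; subst₂; isEquivalence; module ≡-Reasoning)
import Relation.Binary.Construct.Closure.Equivalence as EqClosure
open import Relation.Binary.Construct.Closure.ReflexiveTransitive using (ε; _◅_)
open import Relation.Binary.Construct.Closure.Symmetric using (fwd)
import Relation.Binary.Reasoning.Setoid as SetoidReasoning

all-or : ∀ {N} {P : Fin N → Set} {V : Set} → (∀ x → P x ⊎ V) → (∀ x → P x) ⊎ V
all-or {zero}  h = inj₁ λ ()
all-or {suc N} h with h zero | all-or (λ x → h (suc x))
... | inj₂ v | _      = inj₂ v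
... | inj₁ _ | inj₂ v = inj₂ v
... | inj₁ p | inj₁ ps = inj₁ λ { zero → p ; (suc x) → ps x }

∑ : ∀ {N} → (Fin N → ℕ) → ℕ
∑ {zero}  f = 0
∑ {suc N} f = f zero + ∑ (λ x → f (suc x))

∑-mono-≤ : ∀ {N} {f g : Fin N → ℕ} → (∀ x → f x ≤ g x) → ∑ f ≤ ∑ g
∑-mono-≤ {zero}  f≤g = z≤n
∑-mono-≤ {suc N} f≤g = +-mono-≤ (f≤g zero) (∑-mono-≤ (λ x → f≤g (suc x)))

∑-mono-< : ∀ {N} {f g : Fin N → ℕ} → (∀ x → f x ≤ g x) → ∀ y → f y < g y → ∑ f < ∑ g
∑-mono-< f≤g zero    lt = +-mono-<-≤ lt (∑-mono-≤ (λ x → f≤g (suc x)))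
∑-mono-< f≤g (suc y) lt = +-mono-≤-< (f≤g zero) (∑-mono-< (λ x → f≤g (suc x)) y lt)

module WordCongruence {n : ℕ} (M : CoxeterMatrix n) where
  open CoxeterMatrix M using (m; diag) renaming (sym to m-sym)
  open Coxeter M

  ≈-setoid : Setoid 0ℓ 0ℓ
  ≈-setoid = EqClosure.setoid RelStep

  open Setoid ≈-setoid public
    using () renaming (refl to ≈-refl; sym to ≈-sym; trans to ≈-trans; reflexive to ≡⇒≈)
  module ≈-Reasoning = SetoidReasoning ≈-setoid

  relator-elim : ∀ {i j k} → m i j ≡ just k → ∀ u v → u ++ relator i j k ++ v ≈ u ++ v
  relator-elim e u v = fwd (elim u v _ _ _ e) ◅ ε

  ++-congˡ : ∀ p {a b} → a ≈ b → p ++ a ≈ p ++ b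
  ++-congˡ p = EqClosure.gfold (Setoid.isEquivalence ≈-setoid) (p ++_) step
    where
    step : ∀ {a b} → RelStep a b → p ++ a ≈ p ++ b
    step (elim u v i j k e) = begin
      p ++ u ++ relator i j k ++ v   ≡⟨ ++-assoc p u _ ⟨
      (p ++ u) ++ relator i j k ++ v ≈⟨ relator-elim e (p ++ u) v ⟩
      (p ++ u) ++ v                  ≡⟨ ++-assoc p u v ⟩
      p ++ u ++ v                    ∎
      where open ≈-Reasoning

  ++-congʳ : ∀ q {a b} → a ≈ b → a ++ q ≈ b ++ q
  ++-congʳ q = EqClosure.gfold (Setoid.isEquivalence ≈-setoid) (_++ q) step
    where
    step : ∀ {a b} → RelStep a b → a ++ q ≈ b ++ q
    step (elim u v i j k e) = begin
      (u ++ relator i j k ++ v) ++ q ≡⟨ trans (++-assoc u _ q) (cong (u ++_) (++-assoc (relator i j k) v q)) ⟩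
      u ++ relator i j k ++ v ++ q   ≈⟨ relator-elim e u (v ++ q) ⟩
      u ++ v ++ q                    ≡⟨ ++-assoc u v q ⟨
      (u ++ v) ++ q                  ∎
      where open ≈-Reasoning

  ++-cong : ∀ {a b c d} → a ≈ b → c ≈ d → a ++ c ≈ b ++ d
  ++-cong {b = b} {c = c} a≈b c≈d = ≈-trans (++-congʳ c a≈b) (++-congˡ b c≈d)

  relator-snoc : ∀ i j k → relator i j k ++ i ∷ j ∷ [] ≡ i ∷ j ∷ relator i j k
  relator-snoc i j zero    = refl
  relator-snoc i j (suc k) = cong (λ w → i ∷ j ∷ w) (relator-snoc i j k)

  reverse-relator : ∀ i j k → reverse (relator i j k) ≡ relator j i k
  reverse-relator i j zero    = refl
  reverse-relator i j (suc k) = begin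
    reverse (i ∷ j ∷ relator i j k)             ≡⟨ reverse-++ (i ∷ j ∷ []) (relator i j k) ⟩
    reverse (relator i j k) ++ j ∷ i ∷ []       ≡⟨ cong (_++ j ∷ i ∷ []) (reverse-relator i j k) ⟩
    relator j i k ++ j ∷ i ∷ []                 ≡⟨ relator-snoc j i k ⟩
    relator j i (suc k)                         ∎
    where open ≡-Reasoning

  reverse-cong : ∀ {a b} → a ≈ b → reverse a ≈ reverse b
  reverse-cong = EqClosure.gfold (Setoid.isEquivalence ≈-setoid) reverse step
    where
    step : ∀ {a b} → RelStep a b → reverse a ≈ reverse b
    step (elim u v i j k e) = begin
      reverse (u ++ relator i j k ++ v)                 ≡⟨ reverse-++ u _ ⟩
      reverse (relator i j k ++ v) ++ reverse u         ≡⟨ cong (_++ reverse u) (reverse-++ (relator i j k) v) ⟩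
      (reverse v ++ reverse (relator i j k)) ++ reverse u ≡⟨ ++-assoc (reverse v) _ _ ⟩
      reverse v ++ reverse (relator i j k) ++ reverse u ≡⟨ cong (λ r → reverse v ++ r ++ reverse u) (reverse-relator i j k) ⟩
      reverse v ++ relator j i k ++ reverse u           ≈⟨ relator-elim (trans (m-sym j i) e) (reverse v) (reverse u) ⟩
      reverse v ++ reverse u                            ≡⟨ reverse-++ u v ⟨
      reverse (u ++ v)                                  ∎
      where open ≈-Reasoning

  ∷-involutive : ∀ i w → i ∷ i ∷ w ≈ w
  ∷-involutive i = relator-elim (diag i) []

  inverseʳ : ∀ u w → u ++ reverse u ++ w ≈ w
  inverseʳ []      w = ≈-refl
  inverseʳ (a ∷ u) w = begin
    a ∷ u ++ reverse (a ∷ u) ++ w ≡⟨ cong (λ r → a ∷ u ++ r ++ w) (unfold-reverse a u) ⟩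
    a ∷ u ++ (reverse u ++ [ a ]) ++ w ≡⟨ cong (λ r → a ∷ u ++ r) (++-assoc (reverse u) [ a ] w) ⟩
    a ∷ u ++ reverse u ++ a ∷ w   ≈⟨ ++-congˡ [ a ] (inverseʳ u (a ∷ w)) ⟩
    a ∷ a ∷ w                     ≈⟨ ∷-involutive a w ⟩
    w                             ∎
    where open ≈-Reasoning

  inverseˡ : ∀ u w → reverse u ++ u ++ w ≈ w
  inverseˡ u w = subst (λ r → reverse u ++ r ++ w ≈ w) (reverse-involutive u) (inverseʳ (reverse u) w)

  inverseʳ′ : ∀ w u → w ++ u ++ reverse u ≈ w
  inverseʳ′ w u = begin
    w ++ u ++ reverse u      ≡⟨ cong (λ r → w ++ u ++ r) (++-identityʳ (reverse u)) ⟨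
    w ++ u ++ reverse u ++ [] ≈⟨ ++-congˡ w (inverseʳ u []) ⟩
    w ++ []                  ≡⟨ ++-identityʳ w ⟩
    w                        ∎
    where open ≈-Reasoning

  inverseˡ′ : ∀ w u → w ++ reverse u ++ u ≈ w
  inverseˡ′ w u = subst (λ r → w ++ reverse u ++ r ≈ w) (reverse-involutive u) (inverseʳ′ w (reverse u))

  reverse-++≈[]⇒≈ : ∀ {u w} → reverse u ++ w ≈ [] → u ≈ w
  reverse-++≈[]⇒≈ {u} {w} u⁻¹w≈[] = begin
    u                   ≡⟨ ++-identityʳ u ⟨
    u ++ []             ≈⟨ ++-congˡ u u⁻¹w≈[] ⟨
    u ++ reverse u ++ w ≈⟨ inverseʳ u w ⟩
    w                   ∎
    where open ≈-Reasoning

  ++-cancelˡ : ∀ c {x y} → c ++ x ≈ c ++ y → x ≈ y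
  ++-cancelˡ c {x} {y} cx≈cy = begin
    x                  ≈⟨ inverseˡ c x ⟨
    reverse c ++ c ++ x ≈⟨ ++-congˡ (reverse c) cx≈cy ⟩
    reverse c ++ c ++ y ≈⟨ inverseˡ c y ⟩
    y                  ∎
    where open ≈-Reasoning

module FiniteDecidability {n : ℕ} (M : CoxeterMatrix n) (finite : Coxeter.Finite M) where
  open CoxeterMatrix M using (m)
  open Coxeter M
  open WordCongruence M

  N : ℕ
  N = length (proj₁ finite)

  element : Fin N → Word
  element = lookup (proj₁ finite)

  index-of : Word → Fin N
  index-of w = index (proj₁ (proj₂ (proj₂ finite w)))

  element-index : ∀ w → element (index-of w) ≈ w
  element-index w with proj₂ finite w
  ... | _ , u∈L , w≈u = ≈-sym (≈-trans w≈u (≡⇒≈ (lookup-index u∈L)))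

  act : Word → Fin N → Fin N
  act []      a = a
  act (i ∷ w) a = index-of (i ∷ element (act w a))

  act-sound : ∀ w a → element (act w a) ≈ w ++ element a
  act-sound []      a = ≈-refl
  act-sound (i ∷ w) a = ≈-trans (element-index _) (++-congˡ [ i ] (act-sound w a))

  act-++ : ∀ u v a → act (u ++ v) a ≡ act u (act v a)
  act-++ []      v a = refl
  act-++ (i ∷ u) v a = cong (λ b → index-of (i ∷ element b)) (act-++ u v a)

  -- index-of picks representatives arbitrarily, so act need not respect ≈.  A labelling of the
  -- representatives that only merges equal elements (Sound) and is compatible with the relators
  -- and the action (Stable) turns label (act w origin) into an invariant of the class of w; one is
  -- reached from the identity by merging the two labels of a defect until none is left.
  Labelling : Set
  Labelling = Fin N → Fin N

  Sound : Labelling → Set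
  Sound c = ∀ a → element a ≈ element (c a)

  Stable : Labelling → Set
  Stable c = (∀ a i j k → m i j ≡ just k → c (act (relator i j k) a) ≡ c a)
           × (∀ a b i → c a ≡ c b → c (act [ i ] a) ≡ c (act [ i ] b))

  Defect : Labelling → Set
  Defect c = ∃₂ λ a b → c a ≢ c b × element a ≈ element b

  relator-stable-or-defect : ∀ c a i j → (∀ k → m i j ≡ just k → c (act (relator i j k) a) ≡ c a) ⊎ Defect c
  relator-stable-or-defect c a i j with m i j in mij
  ... | nothing = inj₁ λ _ ()
  ... | just k with c (act (relator i j k) a) ≟ c a
  ...   | yes eq = inj₁ λ { _ refl → eq }
  ...   | no neq = inj₂ (_ , a , neq , ≈-trans (act-sound (relator i j k) a) (relator-elim mij [] (element a)))

  action-stable-or-defect : ∀ c → Sound c → ∀ a b i → (c a ≡ c b → c (act [ i ] a) ≡ c (act [ i ] b)) ⊎ Defect c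
  action-stable-or-defect c sound a b i with c a ≟ c b
  ... | no neq = inj₁ λ eq → ⊥-elim (neq eq)
  ... | yes eq with c (act [ i ] a) ≟ c (act [ i ] b)
  ...   | yes eq′ = inj₁ λ _ → eq′
  ...   | no neq′ = inj₂ (_ , _ , neq′ , ia≈ib)
    where
    a≈b : element a ≈ element b
    a≈b = ≈-trans (sound a) (≈-trans (≡⇒≈ (cong element eq)) (≈-sym (sound b)))
    ia≈ib : element (act [ i ] a) ≈ element (act [ i ] b)
    ia≈ib = ≈-trans (act-sound [ i ] a) (≈-trans (++-congˡ [ i ] a≈b) (≈-sym (act-sound [ i ] b)))

  stable-or-defect : ∀ c → Sound c → Stable c ⊎ Defect c
  stable-or-defect c sound
    with all-or (λ a → all-or (λ i → all-or (λ j → relator-stable-or-defect c a i j)))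
       | all-or (λ a → all-or (λ b → all-or (λ i → action-stable-or-defect c sound a b i)))
  ... | inj₂ d | _      = inj₂ d
  ... | inj₁ _ | inj₂ d = inj₂ d
  ... | inj₁ r | inj₁ s = inj₁ (r , s)

  weight : Labelling → ℕ
  weight c = ∑ (λ a → toℕ (c a))

  relabel : Labelling → Fin N → Fin N → Labelling
  relabel c p q a with c a ≟ q
  ... | yes _ = p
  ... | no  _ = c a

  merge : ∀ c → Sound c → ∀ x y → toℕ (c x) < toℕ (c y) → element x ≈ element y →
          Σ Labelling λ c′ → Sound c′ × weight c′ < weight c
  merge c sound x y cx<cy x≈y = relabel c (c x) (c y) , sound′ , ∑-mono-< lowers y lowers-y
    where
    sound′ : Sound (relabel c (c x) (c y))
    sound′ a with c a ≟ c y
    ... | yes eq = ≈-trans (sound a) (≈-trans (≡⇒≈ (cong element eq))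
                     (≈-trans (≈-sym (sound y)) (≈-trans (≈-sym x≈y) (sound x))))
    ... | no  _  = sound a
    lowers : ∀ a → toℕ (relabel c (c x) (c y) a) ≤ toℕ (c a)
    lowers a with c a ≟ c y
    ... | yes eq = subst (λ l → toℕ (c x) ≤ toℕ l) (sym eq) (<⇒≤ cx<cy)
    ... | no  _    = ≤-refl
    lowers-y : toℕ (relabel c (c x) (c y) y) < toℕ (c y)
    lowers-y with c y ≟ c y
    ... | yes _   = cx<cy
    ... | no  neq = ⊥-elim (neq refl)

  resolve : ∀ c → Sound c → Defect c → Σ Labelling λ c′ → Sound c′ × weight c′ < weight c
  resolve c sound (x , y , neq , x≈y) with <-cmp (c x) (c y)
  ... | tri< lt _ _ = merge c sound x y lt x≈y
  ... | tri≈ _ eq _ = ⊥-elim (neq eq)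
  ... | tri> _ _ gt = merge c sound y x gt (≈-sym x≈y)

  refine : ∀ c → Sound c → Acc _<_ (weight c) → Σ Labelling λ c′ → Sound c′ × Stable c′
  refine c sound (acc rec) with stable-or-defect c sound
  ... | inj₁ stable = c , sound , stable
  ... | inj₂ defect with resolve c sound defect
  ...   | c′ , sound′ , lighter = refine c′ sound′ (rec lighter)

  -- Opaque, like shortest below: type checking must never run the search.
  opaque
    stable-labelling : Σ Labelling λ c → Sound c × Stable c
    stable-labelling = refine (λ a → a) (λ _ → ≈-refl) (<-wellFounded _)

  private
    label : Labelling
    label = proj₁ stable-labelling

    sound : Sound label
    sound = proj₁ (proj₂ stable-labelling)

    stable : Stable label
    stable = proj₂ (proj₂ stable-labelling)

  label-act : ∀ u {a b} → label a ≡ label b → label (act u a) ≡ label (act u b)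
  label-act []      eq = eq
  label-act (i ∷ u) eq = proj₂ stable _ _ i (label-act u eq)

  label-act-cong : ∀ a {w w′} → w ≈ w′ → label (act w a) ≡ label (act w′ a)
  label-act-cong a = EqClosure.gfold isEquivalence (λ w → label (act w a)) step
    where
    step : ∀ {w w′} → RelStep w w′ → label (act w a) ≡ label (act w′ a)
    step (elim u v i j k e) = begin
      label (act (u ++ relator i j k ++ v) a)   ≡⟨ cong label (act-++ u _ a) ⟩
      label (act u (act (relator i j k ++ v) a))
        ≡⟨ label-act u (trans (cong label (act-++ (relator i j k) v a)) (proj₁ stable _ i j k e)) ⟩
      label (act u (act v a))                   ≡⟨ cong label (act-++ u v a) ⟨
      label (act (u ++ v) a)                    ∎
      where open ≡-Reasoning

  origin : Fin N
  origin = index-of []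

  ≈-label : ∀ w → w ≈ element (label (act w origin))
  ≈-label w = begin
    w                                  ≡⟨ ++-identityʳ w ⟨
    w ++ []                            ≈⟨ ++-congˡ w (element-index []) ⟨
    w ++ element origin                ≈⟨ act-sound w origin ⟨
    element (act w origin)             ≈⟨ sound _ ⟩
    element (label (act w origin))     ∎
    where open ≈-Reasoning

  _≈?_ : ∀ u v → Dec (u ≈ v)
  u ≈? v with label (act u origin) ≟ label (act v origin)
  ... | yes eq  = yes (≈-trans (≈-label u) (≈-trans (≡⇒≈ (cong element eq)) (≈-sym (≈-label v))))
  ... | no  neq = no λ u≈v → neq (label-act-cong origin u≈v)

module LengthFunction {n : ℕ} (M : CoxeterMatrix n) (_≈?_ : ∀ u v → Dec (Coxeter._≈_ M u v)) where
  open Coxeter M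
  open WordCongruence M

  of-length? : ∀ k {P : Word → Set} → (∀ u → Dec (P u)) → Dec (∃ λ u → length u ≡ k × P u)
  of-length? zero P? with P? []
  ... | yes p  = yes ([] , refl , p)
  ... | no  ¬p = no λ { ([] , _ , p) → ¬p p }
  of-length? (suc k) {P} P? = map′ extend restrict (any? (λ i → of-length? k (λ u → P? (i ∷ u))))
    where
    extend : (∃ λ i → ∃ λ u → length u ≡ k × P (i ∷ u)) → ∃ λ u → length u ≡ suc k × P u
    extend (i , u , refl , p) = i ∷ u , refl , p
    restrict : (∃ λ u → length u ≡ suc k × P u) → ∃ λ i → ∃ λ u → length u ≡ k × P (i ∷ u)
    restrict (i ∷ u , eq , p) = i , u , suc-injective eq , p

  Shortest : Word → Set
  Shortest w = Σ Word λ u → u ≈ w × (∀ v → v ≈ w → length u ≤ length v)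

  shortest-above : ∀ w k d → k + d ≡ length w → (∀ v → v ≈ w → k ≤ length v) → Shortest w
  shortest-above w k d k+d≡ k≤ with of-length? k (λ u → u ≈? w)
  ... | yes (u , refl , u≈w) = u , u≈w , k≤
  shortest-above w k zero    k+d≡ k≤ | no none = ⊥-elim (none (w , sym (trans (sym (+-identityʳ k)) k+d≡) , ≈-refl))
  shortest-above w k (suc d) k+d≡ k≤ | no none =
    shortest-above w (suc k) d (trans (sym (+-suc k d)) k+d≡)
      (λ v v≈w → ≤∧≢⇒< (k≤ v v≈w) (λ eq → none (v , sym eq , v≈w)))

  opaque
    shortest : ∀ w → Shortest w
    shortest w = shortest-above w 0 (length w) refl (λ _ _ → z≤n)

  reduced : Word → Word
  reduced w = proj₁ (shortest w)

  reduced≈ : ∀ w → reduced w ≈ w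
  reduced≈ w = proj₁ (proj₂ (shortest w))

  ℓ : Word → ℕ
  ℓ w = length (reduced w)

  ℓ-minimal : ∀ w v → v ≈ w → ℓ w ≤ length v
  ℓ-minimal w = proj₂ (proj₂ (shortest w))

  Len-ℓ : ∀ w → Len w (ℓ w)
  Len-ℓ w = (reduced w , reduced≈ w , refl) , ℓ-minimal w

  Len⇒≡ℓ : ∀ {w k} → Len w k → k ≡ ℓ w
  Len⇒≡ℓ {w} ((u , u≈w , refl) , k-minimal) = ≤-antisym (k-minimal (reduced w) (reduced≈ w)) (ℓ-minimal w u u≈w)

  ℓ-cong : ∀ {w w′} → w ≈ w′ → ℓ w ≡ ℓ w′
  ℓ-cong {w} w≈w′ = Len⇒≡ℓ ((reduced w , ≈-trans (reduced≈ w) w≈w′ , refl) ,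
                            λ u u≈w′ → ℓ-minimal w u (≈-trans u≈w′ (≈-sym w≈w′)))

  ℓ≤length : ∀ w → ℓ w ≤ length w
  ℓ≤length w = ℓ-minimal w w ≈-refl

  ℓ-reverse : ∀ w → ℓ (reverse w) ≡ ℓ w
  ℓ-reverse w = sym (Len⇒≡ℓ ((reverse (reduced w) , reverse-cong (reduced≈ w) , length-reverse (reduced w)) , minimal))
    where
    minimal : ∀ u → u ≈ reverse w → ℓ w ≤ length u
    minimal u u≈ = subst (ℓ w ≤_) (length-reverse u)
      (ℓ-minimal w (reverse u) (subst (reverse u ≈_) (reverse-involutive w) (reverse-cong u≈)))

  ℓ-++ : ∀ u v → ℓ (u ++ v) ≤ ℓ u + ℓ v
  ℓ-++ u v = subst (ℓ (u ++ v) ≤_) (length-++ (reduced u))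
    (ℓ-minimal (u ++ v) (reduced u ++ reduced v) (++-cong (reduced≈ u) (reduced≈ v)))

  ℓ-[] : ℓ [] ≡ 0
  ℓ-[] = n≤0⇒n≡0 (ℓ≤length [])

  ℓ≡0⇒≈[] : ∀ w → ℓ w ≡ 0 → w ≈ []
  ℓ≡0⇒≈[] w ℓw≡0 with reduced w | reduced≈ w | ℓw≡0
  ... | [] | []≈w | _ = ≈-sym []≈w

  ℓ-∷ : ∀ i w → ℓ (i ∷ w) ≤ suc (ℓ w)
  ℓ-∷ i w = ≤-trans (ℓ-++ [ i ] w) (+-mono-≤ (ℓ≤length [ i ]) ≤-refl)

  ℓ-∷ʳ : ∀ w i → ℓ (w ++ [ i ]) ≤ suc (ℓ w)
  ℓ-∷ʳ w i = ≤-trans (ℓ-++ w [ i ]) (subst (ℓ w + ℓ [ i ] ≤_) (+-comm (ℓ w) 1)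
                                            (+-mono-≤ ≤-refl (ℓ≤length [ i ])))

  ℓ-∷ʳ-≥ : ∀ w i → ℓ w ≤ suc (ℓ (w ++ [ i ]))
  ℓ-∷ʳ-≥ w i = subst (_≤ suc (ℓ (w ++ [ i ]))) (ℓ-cong w·i·i≈w) (ℓ-∷ʳ (w ++ [ i ]) i)
    where
    w·i·i≈w : (w ++ [ i ]) ++ [ i ] ≈ w
    w·i·i≈w = ≈-trans (≡⇒≈ (++-assoc w [ i ] [ i ]))
                (≈-trans (++-congˡ w (∷-involutive i [])) (≡⇒≈ (++-identityʳ w)))

  Reduced : Word → Set
  Reduced w = length w ≡ ℓ w

  reduced-tail : ∀ s v → Reduced (s ∷ v) → Reduced v
  reduced-tail s v red = ≤-antisym (s≤s⁻¹ (subst (_≤ suc (ℓ v)) (sym red) (ℓ-∷ s v))) (ℓ≤length v)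

  ℓ-∷-<⇒≡ : ∀ {i x} → ℓ x < ℓ (i ∷ x) → ℓ (i ∷ x) ≡ suc (ℓ x)
  ℓ-∷-<⇒≡ {i} {x} = ≤-antisym (ℓ-∷ i x)

  left-descent-or-[] : ∀ d → d ≈ [] ⊎ ∃ λ s → ℓ (s ∷ d) < ℓ d
  left-descent-or-[] d with reduced d | reduced≈ d
  ... | []     | []≈d  = inj₁ (≈-sym []≈d)
  ... | s ∷ d′ | sd′≈d =
    inj₂ (s , s≤s (ℓ-minimal (s ∷ d) d′ (≈-trans (≈-sym (∷-involutive s d′)) (++-congˡ [ s ] sd′≈d))))

  ℓ-∷-geodesic : ∀ u i x → length u + suc (ℓ x) ≤ ℓ (u ++ i ∷ x) → ℓ (i ∷ x) ≡ suc (ℓ x)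
  ℓ-∷-geodesic u i x long = ≤-antisym (ℓ-∷ i x) (+-cancelˡ-≤ (length u) _ _ (begin
    length u + suc (ℓ x)   ≤⟨ long ⟩
    ℓ (u ++ i ∷ x)         ≤⟨ ℓ-++ u (i ∷ x) ⟩
    ℓ u + ℓ (i ∷ x)        ≤⟨ +-monoˡ-≤ (ℓ (i ∷ x)) (ℓ≤length u) ⟩
    length u + ℓ (i ∷ x)   ∎))
    where open ≤-Reasoning

  ≤R-intro : ∀ {u w} → ℓ w ≡ ℓ u + ℓ (reverse u ++ w) → u ≤R w
  ≤R-intro {u} {w} eq = ℓ u , ℓ (reverse u ++ w) , ℓ w , Len-ℓ u , Len-ℓ _ , Len-ℓ w , eq

  ≤R-elim : ∀ {u w} → u ≤R w → ℓ w ≡ ℓ u + ℓ (reverse u ++ w)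
  ≤R-elim (_ , _ , _ , Lu , Lu⁻¹w , Lw , eq) =
    trans (sym (Len⇒≡ℓ Lw)) (trans eq (cong₂ _+_ (Len⇒≡ℓ Lu) (Len⇒≡ℓ Lu⁻¹w)))

  ≈⇒≤R : ∀ {u w} → u ≈ w → u ≤R w
  ≈⇒≤R {u} {w} u≈w = ≤R-intro (begin
    ℓ w                         ≡⟨ ℓ-cong u≈w ⟨
    ℓ u                         ≡⟨ +-identityʳ (ℓ u) ⟨
    ℓ u + 0                     ≡⟨ cong (ℓ u +_) (trans (ℓ-cong u⁻¹w≈[]) ℓ-[]) ⟨
    ℓ u + ℓ (reverse u ++ w)    ∎)
    where
    open ≡-Reasoning
    u⁻¹w≈[] : reverse u ++ w ≈ []
    u⁻¹w≈[] = ≈-trans (++-congˡ (reverse u) (≈-sym u≈w)) (inverseˡ′ [] u)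

  ≤R-antisym : ∀ {u w} → u ≤R w → w ≤R u → u ≈ w
  ≤R-antisym {u} {w} u≤w w≤u = reverse-++≈[]⇒≈ (ℓ≡0⇒≈[] _ (m+n≡0⇒m≡0 A A+B≡0))
    where
    A B : ℕ
    A = ℓ (reverse u ++ w)
    B = ℓ (reverse w ++ u)
    A+B≡0 : A + B ≡ 0
    A+B≡0 = +-cancelˡ-≡ (ℓ u) (A + B) 0 (begin
      ℓ u + (A + B)   ≡⟨ +-assoc (ℓ u) A B ⟨
      (ℓ u + A) + B   ≡⟨ cong (_+ B) (≤R-elim u≤w) ⟨
      ℓ w + B         ≡⟨ ≤R-elim w≤u ⟨
      ℓ u             ≡⟨ +-identityʳ (ℓ u) ⟨
      ℓ u + 0         ∎)
      where open ≡-Reasoning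

  Suffix-intro : ∀ {v w} → ℓ w ≡ ℓ (w ++ reverse v) + ℓ v → Suffix v w
  Suffix-intro {v} {w} eq = ℓ (w ++ reverse v) , ℓ v , ℓ w , Len-ℓ _ , Len-ℓ v , Len-ℓ w , eq

module ReflectionParity {n : ℕ} (M : CoxeterMatrix n) (_≈?_ : ∀ u v → Dec (Coxeter._≈_ M u v)) where
  open CoxeterMatrix M using (m)
  open Coxeter M
  open WordCongruence M
  open LengthFunction M _≈?_

  _≈ᵇ_ : Word → Word → Bool
  x ≈ᵇ t = does (x ≈? t)

  ≈ᵇ-agree : ∀ {x t y t′} → (x ≈ t → y ≈ t′) → (y ≈ t′ → x ≈ t) → x ≈ᵇ t ≡ y ≈ᵇ t′
  ≈ᵇ-agree {x} {t} {y} {t′} to from with x ≈? t | y ≈? t′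
  ... | yes _ | yes _ = refl
  ... | no  _ | no  _ = refl
  ... | yes p | no ¬q = ⊥-elim (¬q (to p))
  ... | no ¬p | yes q = ⊥-elim (¬p (from q))

  ≈⇒≈ᵇ : ∀ {x t} → x ≈ t → x ≈ᵇ t ≡ true
  ≈⇒≈ᵇ {x} {t} x≈t with x ≈? t
  ... | yes _  = refl
  ... | no ¬p = ⊥-elim (¬p x≈t)

  conj : Word → Word → Word
  conj u x = u ++ x ++ reverse u

  unconj : Word → Word → Word
  unconj u t = reverse u ++ t ++ u

  unconj-conj : ∀ u x → unconj u (conj u x) ≈ x
  unconj-conj u x = begin
    reverse u ++ (u ++ x ++ reverse u) ++ u ≡⟨ cong (reverse u ++_) (trans (++-assoc u _ u) (cong (u ++_) (++-assoc x _ u))) ⟩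
    reverse u ++ u ++ x ++ reverse u ++ u   ≈⟨ inverseˡ u _ ⟩
    x ++ reverse u ++ u                     ≈⟨ inverseˡ′ x u ⟩
    x                                       ∎
    where open ≈-Reasoning

  conj-unconj : ∀ u t → conj u (unconj u t) ≈ t
  conj-unconj u t = subst (λ r → r ++ (reverse u ++ t ++ r) ++ reverse u ≈ t) (reverse-involutive u)
    (unconj-conj (reverse u) t)

  conj-cong : ∀ u {x y} → x ≈ y → conj u x ≈ conj u y
  conj-cong u x≈y = ++-congˡ u (++-congʳ (reverse u) x≈y)

  unconj-cong : ∀ u {x y} → x ≈ y → unconj u x ≈ unconj u y
  unconj-cong u x≈y = ++-congˡ (reverse u) (++-congʳ u x≈y)

  conj≈⇒≈unconj : ∀ u {x t} → conj u x ≈ t → x ≈ unconj u t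
  conj≈⇒≈unconj u {x} e = ≈-trans (≈-sym (unconj-conj u x)) (unconj-cong u e)

  ≈unconj⇒conj≈ : ∀ u {x t} → x ≈ unconj u t → conj u x ≈ t
  ≈unconj⇒conj≈ u {t = t} e = ≈-trans (conj-cong u e) (conj-unconj u t)

  conj-++ : ∀ y x → conj y x ++ y ≈ y ++ x
  conj-++ y x = begin
    (y ++ x ++ reverse y) ++ y ≡⟨ trans (cong (_++ y) (sym (++-assoc y x _))) (++-assoc (y ++ x) _ y) ⟩
    (y ++ x) ++ reverse y ++ y ≈⟨ inverseˡ′ (y ++ x) y ⟩
    y ++ x                     ∎
    where open ≈-Reasoning

  parity : Word → List Word → Bool
  parity t []       = false
  parity t (x ∷ xs) = (x ≈ᵇ t) xor parity t xs

  parity-++ : ∀ t xs ys → parity t (xs ++ ys) ≡ parity t xs xor parity t ys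
  parity-++ t []       ys = refl
  parity-++ t (x ∷ xs) ys = trans (cong ((x ≈ᵇ t) xor_) (parity-++ t xs ys)) (sym (xor-assoc (x ≈ᵇ t) _ _))

  parity-cong : ∀ {t t′} → t ≈ t′ → ∀ xs → parity t xs ≡ parity t′ xs
  parity-cong t≈t′ []       = refl
  parity-cong t≈t′ (x ∷ xs) =
    cong₂ _xor_ (≈ᵇ-agree (λ x≈t → ≈-trans x≈t t≈t′) (λ x≈t′ → ≈-trans x≈t′ (≈-sym t≈t′)))
                (parity-cong t≈t′ xs)

  parity-conj : ∀ u t xs → parity t (map (conj u) xs) ≡ parity (unconj u t) xs
  parity-conj u t []       = refl
  parity-conj u t (x ∷ xs) = cong₂ _xor_ (≈ᵇ-agree (conj≈⇒≈unconj u) (≈unconj⇒conj≈ u)) (parity-conj u t xs)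

  reflections : Word → List Word
  reflections []      = []
  reflections (a ∷ w) = [ a ] ∷ map (conj [ a ]) (reflections w)

  conj-∷ : ∀ a u t → conj [ a ] (conj u t) ≡ conj (a ∷ u) t
  conj-∷ a u t = cong (a ∷_) (trans (++-assoc u _ [ a ])
    (cong (u ++_) (trans (++-assoc t _ [ a ]) (cong (t ++_) (sym (unfold-reverse a u))))))

  reflections-++ : ∀ u v → reflections (u ++ v) ≡ reflections u ++ map (conj u) (reflections v)
  reflections-++ []      v = sym (trans (map-cong ++-identityʳ (reflections v)) (map-id (reflections v)))
  reflections-++ (a ∷ u) v = cong ([ a ] ∷_) (begin
    map (conj [ a ]) (reflections (u ++ v))
      ≡⟨ cong (map (conj [ a ])) (reflections-++ u v) ⟩
    map (conj [ a ]) (reflections u ++ map (conj u) (reflections v))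
      ≡⟨ map-++ (conj [ a ]) (reflections u) _ ⟩
    map (conj [ a ]) (reflections u) ++ map (conj [ a ]) (map (conj u) (reflections v))
      ≡⟨ cong (map (conj [ a ]) (reflections u) ++_) (map-∘ (reflections v)) ⟨
    map (conj [ a ]) (reflections u) ++ map (λ x → conj [ a ] (conj u x)) (reflections v)
      ≡⟨ cong (map (conj [ a ]) (reflections u) ++_) (map-cong (conj-∷ a u) (reflections v)) ⟩
    map (conj [ a ]) (reflections u) ++ map (conj (a ∷ u)) (reflections v)
      ∎)
    where open ≡-Reasoning

  χ : Word → Word → Bool
  χ w t = parity t (reflections w)

  χ-++ : ∀ u v t → χ (u ++ v) t ≡ χ u t xor χ v (unconj u t)
  χ-++ u v t = begin
    parity t (reflections (u ++ v))                                    ≡⟨ cong (parity t) (reflections-++ u v) ⟩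
    parity t (reflections u ++ map (conj u) (reflections v))           ≡⟨ parity-++ t (reflections u) _ ⟩
    χ u t xor parity t (map (conj u) (reflections v))                  ≡⟨ cong (χ u t xor_) (parity-conj u t (reflections v)) ⟩
    χ u t xor χ v (unconj u t)                                         ∎
    where open ≡-Reasoning

  χ-∷ : ∀ a w t → χ (a ∷ w) t ≡ ([ a ] ≈ᵇ t) xor χ w (unconj [ a ] t)
  χ-∷ a w t = cong (([ a ] ≈ᵇ t) xor_) (parity-conj [ a ] t (reflections w))

  χ-congʳ : ∀ w {t t′} → t ≈ t′ → χ w t ≡ χ w t′
  χ-congʳ w t≈t′ = parity-cong t≈t′ (reflections w)

  module _ (i j : Fin n) where
    alternating : ℕ → ℕ → List Word
    alternating r zero    = []
    alternating r (suc c) = (relator i j r ++ [ i ]) ∷ alternating (suc r) c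

    conj-alternating : ∀ r c → map (conj (i ∷ j ∷ [])) (alternating r c) ≡ alternating (suc (suc r)) c
    conj-alternating r zero    = refl
    conj-alternating r (suc c) = cong₂ _∷_ (cong (λ w → i ∷ j ∷ w) shift) (conj-alternating (suc r) c)
      where
      shift : (relator i j r ++ [ i ]) ++ j ∷ i ∷ [] ≡ (i ∷ j ∷ relator i j r) ++ [ i ]
      shift = trans (++-assoc (relator i j r) [ i ] (j ∷ i ∷ []))
        (trans (sym (++-assoc (relator i j r) (i ∷ j ∷ []) [ i ])) (cong (_++ [ i ]) (relator-snoc i j r)))

    reflections-relator : ∀ k → reflections (relator i j k) ≡ alternating 0 (k + k)
    reflections-relator zero    = refl
    reflections-relator (suc k) = begin
      reflections ((i ∷ j ∷ []) ++ relator i j k)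
        ≡⟨ reflections-++ (i ∷ j ∷ []) (relator i j k) ⟩
      [ i ] ∷ (i ∷ j ∷ [ i ]) ∷ map (conj (i ∷ j ∷ [])) (reflections (relator i j k))
        ≡⟨ cong (λ rs → [ i ] ∷ (i ∷ j ∷ [ i ]) ∷ map (conj (i ∷ j ∷ [])) rs) (reflections-relator k) ⟩
      [ i ] ∷ (i ∷ j ∷ [ i ]) ∷ map (conj (i ∷ j ∷ [])) (alternating 0 (k + k))
        ≡⟨ cong (λ rs → [ i ] ∷ (i ∷ j ∷ [ i ]) ∷ rs) (conj-alternating 0 (k + k)) ⟩
      alternating 0 (suc (suc (k + k)))
        ≡⟨ cong (λ c → alternating 0 (suc c)) (+-suc k k) ⟨
      alternating 0 (suc k + suc k)
        ∎
      where open ≡-Reasoning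

    alternating-+ : ∀ r a c → alternating r (a + c) ≡ alternating r a ++ alternating (r + a) c
    alternating-+ r zero    c = cong (λ r′ → alternating r′ c) (sym (+-identityʳ r))
    alternating-+ r (suc a) c = cong ((relator i j r ++ [ i ]) ∷_)
      (trans (alternating-+ (suc r) a c) (cong (λ r′ → alternating (suc r) a ++ alternating r′ c) (sym (+-suc r a))))

    relator-+ : ∀ a c → relator i j (a + c) ≡ relator i j a ++ relator i j c
    relator-+ zero    c = refl
    relator-+ (suc a) c = cong (λ w → i ∷ j ∷ w) (relator-+ a c)

    module _ {k : ℕ} (mij≡k : m i j ≡ just k) where
      parity-alternating-period : ∀ t r c → parity t (alternating (k + r) c) ≡ parity t (alternating r c)
      parity-alternating-period t r zero    = refl
      parity-alternating-period t r (suc c) = cong₂ _xor_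
        (≈ᵇ-agree (≈-trans (≈-sym shift)) (≈-trans shift))
        (trans (cong (λ r′ → parity t (alternating r′ c)) (sym (+-suc k r))) (parity-alternating-period t (suc r) c))
        where
        shift : relator i j (k + r) ++ [ i ] ≈ relator i j r ++ [ i ]
        shift = ≈-trans (≡⇒≈ (trans (cong (_++ [ i ]) (relator-+ k r)) (++-assoc (relator i j k) (relator i j r) [ i ])))
          (relator-elim mij≡k [] _)

      -- The reflections (s_i s_j)^r s_i, r < 2k, of the relator repeat with period k.
      χ-relator : ∀ t → χ (relator i j k) t ≡ false
      χ-relator t = begin
        parity t (reflections (relator i j k))    ≡⟨ cong (parity t) (reflections-relator k) ⟩
        parity t (alternating 0 (k + k))          ≡⟨ cong (parity t) (alternating-+ 0 k k) ⟩
        parity t (alternating 0 k ++ alternating k k)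
          ≡⟨ parity-++ t (alternating 0 k) _ ⟩
        first xor parity t (alternating k k)      ≡⟨ cong (λ r → first xor parity t (alternating r k)) (+-identityʳ k) ⟨
        first xor parity t (alternating (k + 0) k) ≡⟨ cong (first xor_) (parity-alternating-period t 0 k) ⟩
        first xor first                           ≡⟨ xor-same first ⟩
        false                                     ∎
        where
        open ≡-Reasoning
        first : Bool
        first = parity t (alternating 0 k)

  χ-congˡ : ∀ t {w w′} → w ≈ w′ → χ w t ≡ χ w′ t
  χ-congˡ t = EqClosure.gfold isEquivalence (λ w → χ w t) step
    where
    step : ∀ {w w′} → RelStep w w′ → χ w t ≡ χ w′ t
    step (elim u v i j k e) = begin
      χ (u ++ r ++ v) t                              ≡⟨ χ-++ u _ t ⟩
      χ u t xor χ (r ++ v) t′                        ≡⟨ cong (χ u t xor_) (χ-++ r v t′) ⟩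
      χ u t xor (χ r t′ xor χ v (unconj r t′))
        ≡⟨ cong (λ b → χ u t xor (b xor χ v (unconj r t′))) (χ-relator i j e t′) ⟩
      χ u t xor χ v (unconj r t′)                    ≡⟨ cong (χ u t xor_) (χ-congʳ v relator-invisible) ⟩
      χ u t xor χ v t′                               ≡⟨ χ-++ u v t ⟨
      χ (u ++ v) t                                   ∎
      where
      open ≡-Reasoning
      r t′ : Word
      r  = relator i j k
      t′ = unconj u t
      relator≈[] : r ≈ []
      relator≈[] = ≈-trans (≡⇒≈ (sym (++-identityʳ _))) (relator-elim e [] [])
      relator-invisible : unconj r t′ ≈ t′
      relator-invisible = ≈-trans (++-cong (reverse-cong relator≈[]) (++-congˡ t′ relator≈[])) (≡⇒≈ (++-identityʳ t′))

  reflection : Word → Fin n → Word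
  reflection y s = conj y [ s ]

  reverse-reflection : ∀ y s → reverse (reflection y s) ≡ reflection y s
  reverse-reflection y s = begin
    reverse (y ++ s ∷ reverse y)           ≡⟨ reverse-++ y (s ∷ reverse y) ⟩
    reverse (s ∷ reverse y) ++ reverse y   ≡⟨ cong (_++ reverse y) (unfold-reverse s (reverse y)) ⟩
    (reverse (reverse y) ++ [ s ]) ++ reverse y ≡⟨ cong (λ r → (r ++ [ s ]) ++ reverse y) (reverse-involutive y) ⟩
    (y ++ [ s ]) ++ reverse y              ≡⟨ ++-assoc y [ s ] (reverse y) ⟩
    y ++ s ∷ reverse y                     ∎
    where open ≡-Reasoning

  ReflectionAt : Word → Word → Set
  ReflectionAt r t = ∃ λ p → ∃ λ a → ∃ λ q → r ≡ p ++ a ∷ q × t ≈ reflection p a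

  χ≡true⇒reflectionAt : ∀ r t → χ r t ≡ true → ReflectionAt r t
  χ≡true⇒reflectionAt []      t ()
  χ≡true⇒reflectionAt (a ∷ r) t χ≡true with [ a ] ≈? t | χ-∷ a r t
  ... | yes a≈t | _ = [] , a , r , refl , ≈-sym a≈t
  ... | no  _   | χ-∷-eq with χ≡true⇒reflectionAt r (unconj [ a ] t) (trans (sym χ-∷-eq) χ≡true)
  ...   | p , b , q , refl , at≈ = a ∷ p , b , q , refl , (begin
    t                                ≈⟨ conj-unconj [ a ] t ⟨
    conj [ a ] (unconj [ a ] t)      ≈⟨ conj-cong [ a ] at≈ ⟩
    conj [ a ] (reflection p b)      ≡⟨ conj-∷ a p [ b ] ⟩
    reflection (a ∷ p) b             ∎)
    where open ≈-Reasoning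

  reflection-deletes : ∀ p a q → reflection p a ++ p ++ a ∷ q ≈ p ++ q
  reflection-deletes p a q = begin
    (p ++ a ∷ reverse p) ++ p ++ a ∷ q ≡⟨ ++-assoc p (a ∷ reverse p) _ ⟩
    p ++ a ∷ reverse p ++ p ++ a ∷ q   ≈⟨ ++-congˡ p (++-congˡ [ a ] (inverseˡ p (a ∷ q))) ⟩
    p ++ a ∷ a ∷ q                     ≈⟨ ++-congˡ p (∷-involutive a q) ⟩
    p ++ q                             ∎
    where open ≈-Reasoning

  ℓ-reflectionAt-< : ∀ {r w t} → r ≈ w → ReflectionAt r t → ℓ (t ++ w) < length r
  ℓ-reflectionAt-< {w = w} {t} r≈w (p , a , q , refl , t≈) = begin-strict
    ℓ (t ++ w)                  ≡⟨ ℓ-cong (≈-trans (++-cong t≈ (≈-sym r≈w)) (reflection-deletes p a q)) ⟩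
    ℓ (p ++ q)                  ≤⟨ ℓ≤length (p ++ q) ⟩
    length (p ++ q)             ≡⟨ length-++ p ⟩
    length p + length q         <⟨ +-monoʳ-< (length p) (n<1+n (length q)) ⟩
    length p + length (a ∷ q)   ≡⟨ length-++ p ⟨
    length (p ++ a ∷ q)         ∎
    where open ≤-Reasoning

  ℓ-reflection-< : ∀ w t → χ w t ≡ true → ℓ (t ++ w) < ℓ w
  ℓ-reflection-< w t χ≡true =
    ℓ-reflectionAt-< (reduced≈ w) (χ≡true⇒reflectionAt (reduced w) t (trans (χ-congˡ t (reduced≈ w)) χ≡true))

  χ-reflection-self : ∀ y s → χ (reflection y s) (reflection y s) ≡ true
  χ-reflection-self y s = begin
    χ (y ++ s ∷ reverse y) t                                        ≡⟨ χ-++ y (s ∷ reverse y) t ⟩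
    χ y t xor χ (s ∷ reverse y) t′                                  ≡⟨ cong (χ y t xor_) (χ-∷ s (reverse y) t′) ⟩
    χ y t xor (([ s ] ≈ᵇ t′) xor χ (reverse y) (unconj [ s ] t′))
      ≡⟨ cong₂ (λ b c → χ y t xor (b xor c)) (≈⇒≈ᵇ (≈-sym t′≈s)) (χ-congʳ (reverse y) s-fixes-t′) ⟩
    χ y t xor (true xor χ (reverse y) t′)                           ≡⟨ xor-assoc (χ y t) true _ ⟨
    (χ y t xor true) xor χ (reverse y) t′
      ≡⟨ cong (_xor χ (reverse y) t′) (xor-comm (χ y t) true) ⟩
    (true xor χ y t) xor χ (reverse y) t′                           ≡⟨ xor-assoc true (χ y t) _ ⟩
    true xor (χ y t xor χ (reverse y) t′)                           ≡⟨ cong (true xor_) (χ-++ y (reverse y) t) ⟨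
    true xor χ (y ++ reverse y) t                                   ≡⟨ cong (true xor_) (χ-congˡ t (inverseʳ′ [] y)) ⟩
    true                                                            ∎
    where
    open ≡-Reasoning
    t t′ : Word
    t  = reflection y s
    t′ = unconj y t
    t′≈s : t′ ≈ [ s ]
    t′≈s = unconj-conj y [ s ]
    s-fixes-t′ : unconj [ s ] t′ ≈ t′
    s-fixes-t′ = ≈-trans (unconj-cong [ s ] t′≈s) (≈-trans (∷-involutive s [ s ]) (≈-sym t′≈s))

  ℓ-reflection-> : ∀ y s w → χ w (reflection y s) ≡ false → ℓ w < ℓ (reflection y s ++ w)
  ℓ-reflection-> y s w χ≡false = subst (_< ℓ (t ++ w)) (ℓ-cong ttw≈w) (ℓ-reflection-< (t ++ w) t χ[tw]≡true)
    where
    t : Word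
    t = reflection y s
    χ[tw]≡true : χ (t ++ w) t ≡ true
    χ[tw]≡true = trans (χ-++ t w t) (cong₂ _xor_ (χ-reflection-self y s) (trans (χ-congʳ w (inverseˡ t t)) χ≡false))
    ttw≈w : t ++ t ++ w ≈ w
    ttw≈w = subst (λ r → t ++ r ++ w ≈ w) (reverse-reflection y s) (inverseʳ t w)

  χ≡true⇒ℓ-∷ʳ-< : ∀ y s → χ y (reflection y s) ≡ true → ℓ (y ++ [ s ]) < ℓ y
  χ≡true⇒ℓ-∷ʳ-< y s χ≡true = subst (_< ℓ y) (ℓ-cong (conj-++ y [ s ])) (ℓ-reflection-< y (reflection y s) χ≡true)

  reduced-∷⇒χ≡false : ∀ s v → Reduced (s ∷ v) → χ v [ s ] ≡ false
  reduced-∷⇒χ≡false s v red with χ v [ s ] in χ≡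
  ... | false = refl
  ... | true  = ⊥-elim (<⇒≱ (ℓ-reflection-< v [ s ] χ≡) (subst (ℓ v ≤_) red (≤-trans (ℓ≤length v) (n≤1+n _))))

  generator≉[] : ∀ i → ¬ [ i ] ≈ []
  generator≉[] i i≈[] with trans (sym (χ-reflection-self [] i)) (χ-congˡ [ i ] i≈[])
  ... | ()

  ℓ-generator-positive : ∀ i → 0 < ℓ [ i ]
  ℓ-generator-positive i = n≢0⇒n>0 (λ ℓ≡0 → generator≉[] i (ℓ≡0⇒≈[] [ i ] ℓ≡0))

module LongestElement {n : ℕ} (M : CoxeterMatrix n) (finite : Coxeter.Finite M) where
  open Coxeter M
  open WordCongruence M
  open FiniteDecidability M finite using (_≈?_)
  open LengthFunction M _≈?_
  open ReflectionParity M _≈?_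

  w₀ : Word
  w₀ = argmax ℓ [] (proj₁ finite)

  ℓ≤ℓ[w₀] : ∀ w → ℓ w ≤ ℓ w₀
  ℓ≤ℓ[w₀] w with proj₂ finite w
  ... | u , u∈L , w≈u =
    subst (_≤ ℓ w₀) (ℓ-cong (≈-sym w≈u)) (All.lookup (f[xs]≤f[argmax] {f = ℓ} [] (proj₁ finite)) u∈L)

  χ-w₀ : ∀ y s → χ w₀ (reflection y s) ≡ true
  χ-w₀ y s with χ w₀ (reflection y s) in χ≡
  ... | true  = refl
  ... | false = ⊥-elim (<⇒≱ (ℓ-reflection-> y s w₀ χ≡) (ℓ≤ℓ[w₀] _))

  ℓ-w₀-descent : ∀ s v → Reduced (s ∷ v) → suc (ℓ ((w₀ ++ reverse v) ++ [ s ])) ≡ ℓ (w₀ ++ reverse v)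
  ℓ-w₀-descent s v red = ≤-antisym (χ≡true⇒ℓ-∷ʳ-< y s χ[y]≡true) (ℓ-∷ʳ-≥ y s)
    where
    y t : Word
    y = w₀ ++ reverse v
    t = reflection y s
    χ[y]≡true : χ y t ≡ true
    χ[y]≡true = begin
      χ y t                       ≡⟨ xor-identityʳ (χ y t) ⟨
      χ y t xor false             ≡⟨ cong (χ y t xor_) (reduced-∷⇒χ≡false s v red) ⟨
      χ y t xor χ v [ s ]         ≡⟨ cong (χ y t xor_) (χ-congʳ v (unconj-conj y [ s ])) ⟨
      χ y t xor χ v (unconj y t)  ≡⟨ χ-++ y v t ⟨
      χ (y ++ v) t                ≡⟨ χ-congˡ t (≈-trans (≡⇒≈ (++-assoc w₀ (reverse v) v)) (inverseˡ′ w₀ v)) ⟩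
      χ w₀ t                      ≡⟨ χ-w₀ y s ⟩
      true                        ∎
      where open ≡-Reasoning

  reduced-suffix-of-w₀ : ∀ v → Reduced v → ℓ (w₀ ++ reverse v) + length v ≡ ℓ w₀
  reduced-suffix-of-w₀ []      _   = trans (+-identityʳ _) (cong ℓ (++-identityʳ w₀))
  reduced-suffix-of-w₀ (s ∷ v) red = begin
    ℓ (w₀ ++ reverse (s ∷ v)) + suc (length v)
      ≡⟨ cong (λ w → ℓ (w₀ ++ w) + suc (length v)) (unfold-reverse s v) ⟩
    ℓ (w₀ ++ reverse v ++ [ s ]) + suc (length v)
      ≡⟨ cong (λ w → ℓ w + suc (length v)) (++-assoc w₀ (reverse v) [ s ]) ⟨
    ℓ ((w₀ ++ reverse v) ++ [ s ]) + suc (length v) ≡⟨ +-suc _ (length v) ⟩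
    suc (ℓ ((w₀ ++ reverse v) ++ [ s ])) + length v ≡⟨ cong (_+ length v) (ℓ-w₀-descent s v red) ⟩
    ℓ (w₀ ++ reverse v) + length v              ≡⟨ reduced-suffix-of-w₀ v (reduced-tail s v red) ⟩
    ℓ w₀                                        ∎
    where open ≡-Reasoning

  suffix-of-w₀ : ∀ v → ℓ (w₀ ++ reverse v) + ℓ v ≡ ℓ w₀
  suffix-of-w₀ v = begin
    ℓ (w₀ ++ reverse v) + ℓ v
      ≡⟨ cong (_+ ℓ v) (ℓ-cong (++-congˡ w₀ (reverse-cong (≈-sym (reduced≈ v))))) ⟩
    ℓ (w₀ ++ reverse (reduced v)) + length (reduced v)
      ≡⟨ reduced-suffix-of-w₀ (reduced v) (sym (ℓ-cong (reduced≈ v))) ⟩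
    ℓ w₀                                             ∎
    where open ≡-Reasoning

  w₀-involutive : w₀ ++ w₀ ≈ []
  w₀-involutive = ℓ≡0⇒≈[] (w₀ ++ w₀) (+-cancelʳ-≡ (ℓ w₀) _ 0 (begin
    ℓ (w₀ ++ w₀) + ℓ w₀
      ≡⟨ cong₂ (λ u k → ℓ (w₀ ++ u) + k) (reverse-involutive w₀) (ℓ-reverse w₀) ⟨
    ℓ (w₀ ++ reverse (reverse w₀)) + ℓ (reverse w₀) ≡⟨ suffix-of-w₀ (reverse w₀) ⟩
    ℓ w₀                                            ∎))
    where open ≡-Reasoning

  ·w₀·w₀ : ∀ x → (x ++ w₀) ++ w₀ ≈ x
  ·w₀·w₀ x = ≈-trans (≡⇒≈ (++-assoc x w₀ w₀)) (≈-trans (++-congˡ x w₀-involutive) (≡⇒≈ (++-identityʳ x)))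

  reverse-w₀ : reverse w₀ ≈ w₀
  reverse-w₀ = begin
    reverse w₀             ≡⟨ ++-identityʳ (reverse w₀) ⟨
    reverse w₀ ++ []       ≈⟨ ++-congˡ (reverse w₀) w₀-involutive ⟨
    reverse w₀ ++ w₀ ++ w₀ ≈⟨ inverseˡ w₀ w₀ ⟩
    w₀                     ∎
    where open ≈-Reasoning

  prefix-of-w₀ : ∀ x → ℓ (x ++ w₀) + ℓ x ≡ ℓ w₀
  prefix-of-w₀ x = begin
    ℓ (x ++ w₀) + ℓ x                    ≡⟨ cong (_+ ℓ x) (ℓ-reverse (x ++ w₀)) ⟨
    ℓ (reverse (x ++ w₀)) + ℓ x          ≡⟨ cong (λ u → ℓ u + ℓ x) (reverse-++ x w₀) ⟩
    ℓ (reverse w₀ ++ reverse x) + ℓ x    ≡⟨ cong (_+ ℓ x) (ℓ-cong (++-congʳ (reverse x) reverse-w₀)) ⟩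
    ℓ (w₀ ++ reverse x) + ℓ x            ≡⟨ suffix-of-w₀ x ⟩
    ℓ w₀                                 ∎
    where open ≡-Reasoning

  ℓ≡ℓ[w₀]⇒≈w₀ : ∀ z → ℓ z ≡ ℓ w₀ → z ≈ w₀
  ℓ≡ℓ[w₀]⇒≈w₀ z ℓz≡ = begin
    z               ≈⟨ ·w₀·w₀ z ⟨
    (z ++ w₀) ++ w₀ ≈⟨ ++-congʳ w₀ (ℓ≡0⇒≈[] (z ++ w₀) ℓ[zw₀]≡0) ⟩
    w₀              ∎
    where
    open ≈-Reasoning
    ℓ[zw₀]≡0 : ℓ (z ++ w₀) ≡ 0
    ℓ[zw₀]≡0 = +-cancelʳ-≡ (ℓ z) _ 0 (trans (prefix-of-w₀ z) (sym ℓz≡))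

  all-left-descents⇒≈w₀ : ∀ b → (∀ s → ℓ (s ∷ b) < ℓ b) → b ≈ w₀
  all-left-descents⇒≈w₀ b descent with left-descent-or-[] (b ++ w₀)
  ... | inj₁ d≈[]    = ≈-trans (≈-sym (·w₀·w₀ b)) (++-congʳ w₀ d≈[])
  ... | inj₂ (s , lt) = ⊥-elim (<-irrefl same-sum (+-mono-< (descent s) lt))
    where
    d : Word
    d = b ++ w₀
    same-sum : ℓ (s ∷ b) + ℓ (s ∷ d) ≡ ℓ b + ℓ d
    same-sum = begin
      ℓ (s ∷ b) + ℓ (s ∷ d)        ≡⟨ cong (_+ ℓ (s ∷ d)) (ℓ-cong (++-congˡ [ s ] (·w₀·w₀ b))) ⟨
      ℓ (s ∷ d ++ w₀) + ℓ (s ∷ d)  ≡⟨ prefix-of-w₀ (s ∷ d) ⟩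
      ℓ w₀                         ≡⟨ prefix-of-w₀ d ⟨
      ℓ (d ++ w₀) + ℓ d            ≡⟨ cong (_+ ℓ d) (ℓ-cong (·w₀·w₀ b)) ⟩
      ℓ b + ℓ d                    ∎
      where open ≡-Reasoning

  Generator : Word → Set
  Generator x = ∃ λ i → x ≈ [ i ]

  w₀-upper-bound : UpperBound Generator w₀
  w₀-upper-bound x (i , x≈i) = ≤R-intro (begin
    ℓ w₀                      ≡⟨ prefix-of-w₀ [ i ] ⟨
    ℓ (i ∷ w₀) + ℓ [ i ]      ≡⟨ +-comm _ (ℓ [ i ]) ⟩
    ℓ [ i ] + ℓ (i ∷ w₀)
      ≡⟨ cong₂ _+_ (ℓ-cong (≈-sym x≈i)) (ℓ-cong (++-congʳ w₀ (reverse-cong (≈-sym x≈i)))) ⟩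
    ℓ x + ℓ (reverse x ++ w₀) ∎)
    where open ≡-Reasoning

  w₀-least : ∀ b → UpperBound Generator b → w₀ ≤R b
  w₀-least b b-bound = ≈⇒≤R (≈-sym (all-left-descents⇒≈w₀ b descent))
    where
    descent : ∀ s → ℓ (s ∷ b) < ℓ b
    descent s = subst (ℓ (s ∷ b) <_) (sym (≤R-elim (b-bound [ s ] (s , ≈-refl))))
      (m<n+m (ℓ (s ∷ b)) (ℓ-generator-positive s))

  S̃-everything : ∀ w → S̃ w
  S̃-everything w B shadow = suffixClosed w₀ w w₀∈B (Suffix-intro (sym (suffix-of-w₀ w)))
    where
    open IsGarsideShadow shadow
    w₀∈B : B w₀
    w₀∈B = joinClosed Generator (λ x (i , x≈i) → respects [ i ] x (≈-sym x≈i) (gens i))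
      (w₀ , w₀-upper-bound) w₀ (w₀-upper-bound , w₀-least)

module MinimalAutomaton {n : ℕ} (M : CoxeterMatrix n) (finite : Coxeter.Finite M) where
  open Coxeter M
  open WordCongruence M
  open FiniteDecidability M finite using (_≈?_)
  open LengthFunction M _≈?_
  open LongestElement M finite
  open Automaton S̃

  πS̃-identity : ∀ w y → IsπB w y → y ≈ w
  πS̃-identity w y (upper , least) = ≤R-antisym (least w (λ _ → proj₂)) (upper w (S̃-everything w , ≈⇒≤R ≈-refl))

  πS̃-self : ∀ w → IsπB w w
  πS̃-self w = (λ _ → proj₂) , (λ b bound → bound w (S̃-everything w , ≈⇒≤R ≈-refl))

  Trans⇒ : ∀ {x i z} → Trans x i z → ℓ (i ∷ x) ≡ suc (ℓ x) × z ≈ i ∷ x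
  Trans⇒ ((_ , _ , Lx , Lix , lt) , _ , π) =
    ℓ-∷-<⇒≡ (subst₂ _<_ (Len⇒≡ℓ Lx) (Len⇒≡ℓ Lix) lt) , πS̃-identity _ _ π

  ⇒Trans : ∀ x i → ℓ (i ∷ x) ≡ suc (ℓ x) → Trans x i (i ∷ x)
  ⇒Trans x i grows = (ℓ x , ℓ (i ∷ x) , Len-ℓ x , Len-ℓ _ , ≤-reflexive (sym grows)) , S̃-everything _ , πS̃-self _

  reverse-∷-++ : ∀ (i : Fin n) ws x → reverse (i ∷ ws) ++ x ≡ reverse ws ++ i ∷ x
  reverse-∷-++ i ws x = trans (cong (_++ x) (unfold-reverse i ws)) (++-assoc (reverse ws) [ i ] x)

  -- Letters act on the left: reading ws from x ends in the state reverse ws ++ x.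
  Geodesic : Word → List (Fin n) → Set
  Geodesic x ws = ℓ (reverse ws ++ x) ≡ length ws + ℓ x

  geodesic-step : ∀ x i ws → Geodesic x (i ∷ ws) → ℓ (i ∷ x) ≡ suc (ℓ x) × Geodesic (i ∷ x) ws
  geodesic-step x i ws geo = grows , trans geo′ (cong (length ws +_) (sym grows))
    where
    geo′ : ℓ (reverse ws ++ i ∷ x) ≡ length ws + suc (ℓ x)
    geo′ = trans (cong ℓ (sym (reverse-∷-++ i ws x))) (trans geo (sym (+-suc (length ws) (ℓ x))))
    grows : ℓ (i ∷ x) ≡ suc (ℓ x)
    grows = ℓ-∷-geodesic (reverse ws) i x (≤-reflexive (trans (cong (_+ suc (ℓ x)) (length-reverse ws)) (sym geo′)))

  accepts⇒geodesic : ∀ x ws → Accepts x ws → Geodesic x ws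
  accepts⇒geodesic x []       _                 = refl
  accepts⇒geodesic x (i ∷ ws) (z , step , rest) = begin
    ℓ (reverse (i ∷ ws) ++ x)  ≡⟨ cong ℓ (reverse-∷-++ i ws x) ⟩
    ℓ (reverse ws ++ i ∷ x)    ≡⟨ ℓ-cong (++-congˡ (reverse ws) z≈ix) ⟨
    ℓ (reverse ws ++ z)        ≡⟨ accepts⇒geodesic z ws rest ⟩
    length ws + ℓ z            ≡⟨ cong (length ws +_) (trans (ℓ-cong z≈ix) grows) ⟩
    length ws + suc (ℓ x)      ≡⟨ +-suc (length ws) (ℓ x) ⟩
    suc (length ws + ℓ x)      ∎
    where
    open ≡-Reasoning
    grows : ℓ (i ∷ x) ≡ suc (ℓ x)
    grows = proj₁ (Trans⇒ step)
    z≈ix : z ≈ i ∷ x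
    z≈ix = proj₂ (Trans⇒ step)

  geodesic⇒accepts : ∀ x ws → Geodesic x ws → Accepts x ws
  geodesic⇒accepts x []       _   = tt
  geodesic⇒accepts x (i ∷ ws) geo with geodesic-step x i ws geo
  ... | grows , geo′ = i ∷ x , ⇒Trans x i grows , geodesic⇒accepts (i ∷ x) ws geo′

  geodesic⇒run : ∀ x ws y → Geodesic x ws → y ≈ reverse ws ++ x → Run x ws y
  geodesic⇒run x []       y _   y≈x = ≈-sym y≈x , tt
  geodesic⇒run x (i ∷ ws) y geo y≈ with geodesic-step x i ws geo
  ... | grows , geo′ =
    i ∷ x , ⇒Trans x i grows , geodesic⇒run (i ∷ x) ws y geo′ (≈-trans y≈ (≡⇒≈ (reverse-∷-++ i ws x)))

  geodesic-[]⇔reduced : ∀ ws → (Geodesic [] ws → Reduced ws) × (Reduced ws → Geodesic [] ws)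
  geodesic-[]⇔reduced ws =
    (λ geo → sym (trans (sym ℓ-read) (trans geo length+0))) ,
    (λ red → trans ℓ-read (trans (sym red) (sym length+0)))
    where
    ℓ-read : ℓ (reverse ws ++ []) ≡ ℓ ws
    ℓ-read = trans (cong ℓ (++-identityʳ (reverse ws))) (ℓ-reverse ws)
    length+0 : length ws + ℓ [] ≡ length ws
    length+0 = trans (cong (length ws +_) ℓ-[]) (+-identityʳ (length ws))

  recognizes : ∀ ws → (Accepts [] ws → Red ws) × (Red ws → Accepts [] ws)
  recognizes ws =
    (λ accepted → subst (Len ws) (sym (proj₁ (geodesic-[]⇔reduced ws) (accepts⇒geodesic [] ws accepted))) (Len-ℓ ws)) ,
    (λ red → geodesic⇒accepts [] ws (proj₂ (geodesic-[]⇔reduced ws) (Len⇒≡ℓ red)))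

  reachable : ∀ y → S̃ y → ∃ λ ws → Run [] ws y
  reachable y _ = reverse r , geodesic⇒run [] (reverse r) y (proj₂ (geodesic-[]⇔reduced (reverse r)) reduced-r⁻¹) y≈
    where
    r : Word
    r = reduced y
    reduced-r⁻¹ : Reduced (reverse r)
    reduced-r⁻¹ = trans (length-reverse r) (sym (trans (ℓ-reverse r) (ℓ-cong (reduced≈ y))))
    y≈ : y ≈ reverse (reverse r) ++ []
    y≈ = ≈-trans (≈-sym (reduced≈ y)) (≡⇒≈ (sym (trans (++-identityʳ _) (reverse-involutive r))))

  -- Read backwards, a reduced word of w₀ x⁻¹ is accepted from x, and from y only if ℓ y ≤ ℓ x.
  complement : Word → Word
  complement x = reduced (w₀ ++ reverse x)

  complement-++ : ∀ x → complement x ++ x ≈ w₀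
  complement-++ x = ≈-trans (++-congʳ x (reduced≈ _)) (≈-trans (≡⇒≈ (++-assoc w₀ (reverse x) x)) (inverseˡ′ w₀ x))

  accepts-complement : ∀ x → Accepts x (reverse (complement x))
  accepts-complement x = geodesic⇒accepts x (reverse c) (begin
    ℓ (reverse (reverse c) ++ x) ≡⟨ cong (λ u → ℓ (u ++ x)) (reverse-involutive c) ⟩
    ℓ (c ++ x)                   ≡⟨ ℓ-cong (complement-++ x) ⟩
    ℓ w₀                         ≡⟨ suffix-of-w₀ x ⟨
    length c + ℓ x               ≡⟨ cong (_+ ℓ x) (length-reverse c) ⟨
    length (reverse c) + ℓ x     ∎)
    where
    open ≡-Reasoning
    c : Word
    c = complement x

  accepts-complement⇒ : ∀ x y → Accepts y (reverse (complement x)) → ℓ (complement x ++ y) ≡ length (complement x) + ℓ y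
  accepts-complement⇒ x y accepted = begin
    ℓ (c ++ y)                    ≡⟨ cong (λ u → ℓ (u ++ y)) (reverse-involutive c) ⟨
    ℓ (reverse (reverse c) ++ y)  ≡⟨ accepts⇒geodesic y (reverse c) accepted ⟩
    length (reverse c) + ℓ y      ≡⟨ cong (_+ ℓ y) (length-reverse c) ⟩
    length c + ℓ y                ∎
    where
    open ≡-Reasoning
    c : Word
    c = complement x

  accepts-complement⇒ℓ≤ : ∀ x y → Accepts y (reverse (complement x)) → ℓ y ≤ ℓ x
  accepts-complement⇒ℓ≤ x y accepted = +-cancelˡ-≤ (length (complement x)) _ _ (begin
    length (complement x) + ℓ y   ≡⟨ accepts-complement⇒ x y accepted ⟨
    ℓ (complement x ++ y)         ≤⟨ ℓ≤ℓ[w₀] _ ⟩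
    ℓ w₀                          ≡⟨ suffix-of-w₀ x ⟨
    length (complement x) + ℓ x   ∎)
    where open ≤-Reasoning

  inequivalent : ∀ x y → S̃ x → S̃ y →
                 (∀ ws → (Accepts x ws → Accepts y ws) × (Accepts y ws → Accepts x ws)) → x ≈ y
  inequivalent x y _ _ same = ++-cancelˡ (complement x) (≈-trans (complement-++ x) (≈-sym cy≈w₀))
    where
    accepted-by-y : Accepts y (reverse (complement x))
    accepted-by-y = proj₁ (same _) (accepts-complement x)
    ℓx≡ℓy : ℓ x ≡ ℓ y
    ℓx≡ℓy = ≤-antisym (accepts-complement⇒ℓ≤ y x (proj₂ (same _) (accepts-complement y)))
                      (accepts-complement⇒ℓ≤ x y accepted-by-y)
    cy≈w₀ : complement x ++ y ≈ w₀
    cy≈w₀ = ℓ≡ℓ[w₀]⇒≈w₀ _ (trans (accepts-complement⇒ x y accepted-by-y)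
      (trans (cong (length (complement x) +_) (sym ℓx≡ℓy)) (suffix-of-w₀ x)))

  S̃-minimal : IsMinimalForRed S̃
  S̃-minimal = record { recognizes = recognizes ; reachable = reachable ; inequivalent = inequivalent }

proposition3p6 : ∀ {n : ℕ} (M : CoxeterMatrix n) → Coxeter.Finite M →
    (∀ w → Coxeter.S̃ M w) × Coxeter.IsMinimalForRed M (Coxeter.S̃ M)
proposition3p6 M finite = LongestElement.S̃-everything M finite , MinimalAutomaton.S̃-minimal M finite
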